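{- Let $(\mathcal{G}_n)_{n\ge1}$ be the pseudofractal scale-free web. For every $n\geq 1$, the independence number of $\mathcal{G}_n$ (the largest cardinality of an independent set of $\mathcal{G}_n$) equals $3^{n-1}$.
   Context: The pseudofractal scale-free web is the sequence of simple graphs $\mathcal{G}_n$, $n\ge 1$, defined by: $\mathcal{G}_1$ is a triangle; for $n>1$, $\mathcal{G}_n$ is obtained from $\mathcal{G}_{n-1}$ by adding, for every edge $(u,v)$ of $\mathcal{G}_{n-1}$, a new vertex adjacent to exactly $u$ and $v$. An independent set is a set of pairwise non-adjacent vertices. -}

module Defs where

open import Data.Nat using (ℕ; zero; suc; _+_; _≤_)
open import Data.Fin using (Fin; zero; suc; _↑ˡ_; _↑ʳ_)
open import Data.Fin.Subset using (Subset; _∈_; ∣_∣)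
open import Data.List using (List; []; _∷_; _++_; length; lookup; concatMap; allFin; map)
open import Data.List.Membership.Propositional renaming (_∈_ to _∈ₗ_)
open import Data.Product using (_×_; _,_; Σ)
open import Relation.Binary.PropositionalEquality using (_≡_)
open import Data.Sum using (_⊎_)
open import Data.Empty using (⊥)

record Graph : Set where
  constructor mkGraph
  field
    V : ℕ
    E : List (Fin V × Fin V)
open Graph public

Adj : (G : Graph) → Fin (V G) → Fin (V G) → Set
Adj G a b = ((a , b) ∈ₗ E G) ⊎ ((b , a) ∈ₗ E G)

triangle : Graph
triangle = mkGraph 3 ((zero , suc zero) ∷ (suc zero , suc (suc zero)) ∷ (zero , suc (suc zero)) ∷ [])

-- one growth step: for every edge (u,w) (the i-th edge) add a new vertex V+i
-- adjacent to exactly u and w; old edges are kept.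
step : Graph → Graph
step (mkGraph v es) = mkGraph (v + length es) (map old es ++ concatMap new (allFin (length es)))
  where
  m = length es
  old : Fin v × Fin v → Fin (v + m) × Fin (v + m)
  old (a , b) = a ↑ˡ m , b ↑ˡ m
  new : Fin m → List (Fin (v + m) × Fin (v + m))
  new i with lookup es i
  ... | (u , w) = (v ↑ʳ i , u ↑ˡ m) ∷ (v ↑ʳ i , w ↑ˡ m) ∷ []

-- web k = 𝒢_(k+1)
web : ℕ → Graph
web zero = triangle
web (suc k) = step (web k)

-- 𝒢 n for n ≥ 1 (𝒢 0 is a dummy equal to 𝒢 1 and never used)
𝒢 : ℕ → Graph
𝒢 zero = triangle
𝒢 (suc k) = web k

Independent : (G : Graph) → Subset (V G) → Set
Independent G S = ∀ a b → Adj G a b → a ∈ S → b ∈ S → ⊥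

IndependenceNumber : Graph → ℕ → Set
IndependenceNumber G k =
  Σ (Subset (V G)) (λ S → Independent G S × ∣ S ∣ ≡ k)
  × (∀ (S : Subset (V G)) → Independent G S → ∣ S ∣ ≤ k)

-- Call a vertex of step G old if it comes from G and new otherwise; new vertices are
-- indexed by the edges of G. The new vertices form an independent set of size |E G|,
-- since every edge of step G has an old endpoint. Conversely, if G has no isolated
-- vertex, pick for each old vertex a of an independent set S = A ∪ B (A old, B new) an
-- edge e(a) of G containing it. Because A is independent in G, a ↦ e(a) is injective
-- on A, and e(a) ∉ B because the new vertex of e(a) is adjacent to a; hence
-- |A| + |B| ≤ |E G|. As |E (step G)| = 3 |E G| and the triangle has independence
-- number 1, the independence number of 𝒢 n is |E (𝒢 (n - 1))| = 3 ^ (n - 1) for n ≥ 2.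
module Submission where

open import Defs
open import Data.Nat using (ℕ; zero; suc; _+_; _*_; _^_; _∸_; _≤_; z≤n; s≤s)
open import Data.Nat.Properties using (+-suc; *-suc; *-zeroʳ)
open import Data.Fin using (Fin; zero; suc; _↑ˡ_; _↑ʳ_)
open import Data.Fin.Properties using (suc-injective)
open import Data.Fin.Subset using (Subset; _∈_; _∉_; ∣_∣; inside; outside) renaming (⊥ to ∅; ⊤ to all)
open import Data.Fin.Subset.Properties using (drop-not-there; ∣p∣≤n; ∉⊥; ∣⊥∣≡0; ∣⊤∣≡n)
open import Data.Vec using ([]; _∷_; here; there; _[_]≔_; splitAt) renaming (_++_ to _++ᵥ_)
open import Data.Vec.Properties using (lookup⇒[]=; []=⇒lookup; lookup-++ˡ; lookup-++ʳ)
open import Data.List using (List; length; lookup; concatMap; allFin; map) renaming (_∷_ to _∷ₗ_; [] to []ₗ; _++_ to _++ₗ_)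
open import Data.List.Properties using (length-map; length-++; length-tabulate)
open import Data.List.Membership.Propositional using (lose) renaming (_∈_ to _∈ₗ_)
open import Data.List.Membership.Propositional.Properties using (∈-lookup; ∈-map⁺; ∈-map⁻; ∈-++⁺ˡ; ∈-++⁺ʳ; ∈-++⁻; ∈-concatMap⁺; ∈-concatMap⁻; ∈-allFin)
open import Data.List.Relation.Unary.Any using (index; satisfied) renaming (here to hereₗ; there to thereₗ)
open import Data.List.Relation.Unary.Any.Properties using (lookup-index)
open import Data.Product using (_×_; _,_; proj₁; proj₂; ∃-syntax)
open import Data.Sum using (_⊎_; inj₁; inj₂)
import Data.Sum as Sum
open import Data.Empty using (⊥-elim)
open import Relation.Binary.PropositionalEquality using (_≡_; refl; sym; trans; cong; cong₂; subst; module ≡-Reasoning)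

x∉p⇒∣p[x]≔inside∣≡1+∣p∣ : ∀ {n} (p : Subset n) {x} → x ∉ p → ∣ p [ x ]≔ inside ∣ ≡ suc ∣ p ∣
x∉p⇒∣p[x]≔inside∣≡1+∣p∣ (inside ∷ p) {zero} x∉p = ⊥-elim (x∉p here)
x∉p⇒∣p[x]≔inside∣≡1+∣p∣ (outside ∷ p) {zero} x∉p = refl
x∉p⇒∣p[x]≔inside∣≡1+∣p∣ (inside ∷ p) {suc x} x∉p = cong suc (x∉p⇒∣p[x]≔inside∣≡1+∣p∣ p (drop-not-there x∉p))
x∉p⇒∣p[x]≔inside∣≡1+∣p∣ (outside ∷ p) {suc x} x∉p = x∉p⇒∣p[x]≔inside∣≡1+∣p∣ p (drop-not-there x∉p)

y∈p[x]≔inside⇒y≡x⊎y∈p : ∀ {n} (p : Subset n) x {y} → y ∈ p [ x ]≔ inside → y ≡ x ⊎ y ∈ p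
y∈p[x]≔inside⇒y≡x⊎y∈p (s ∷ p) zero {zero} _ = inj₁ refl
y∈p[x]≔inside⇒y≡x⊎y∈p (s ∷ p) zero {suc y} (there y∈p) = inj₂ (there y∈p)
y∈p[x]≔inside⇒y≡x⊎y∈p (s ∷ p) (suc x) {zero} here = inj₂ here
y∈p[x]≔inside⇒y≡x⊎y∈p (s ∷ p) (suc x) {suc y} (there y∈p′) with y∈p[x]≔inside⇒y≡x⊎y∈p p x y∈p′
... | inj₁ y≡x = inj₁ (cong suc y≡x)
... | inj₂ y∈p = inj₂ (there y∈p)

-- Proved by moving the elements of p one at a time into q, through f.
injective-avoiding⇒∣p∣+∣q∣≤n : ∀ {k n} (p : Subset k) (q : Subset n) (f : Fin k → Fin n) →
  (∀ {x y} → x ∈ p → y ∈ p → f x ≡ f y → x ≡ y) → (∀ {x} → x ∈ p → f x ∉ q) →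
  ∣ p ∣ + ∣ q ∣ ≤ n
injective-avoiding⇒∣p∣+∣q∣≤n [] q f _ _ = ∣p∣≤n q
injective-avoiding⇒∣p∣+∣q∣≤n (outside ∷ p) q f inj avoid =
  injective-avoiding⇒∣p∣+∣q∣≤n p q (λ x → f (suc x))
    (λ x∈p y∈p e → suc-injective (inj (there x∈p) (there y∈p) e)) (λ x∈p → avoid (there x∈p))
injective-avoiding⇒∣p∣+∣q∣≤n {n = n} (inside ∷ p) q f inj avoid =
  subst (_≤ n) ∣p∣+∣q′∣≡1+∣p∣+∣q∣
    (injective-avoiding⇒∣p∣+∣q∣≤n p q′ (λ x → f (suc x))
      (λ x∈p y∈p e → suc-injective (inj (there x∈p) (there y∈p) e)) avoid′)
  where
  q′ = q [ f zero ]≔ inside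
  avoid′ : ∀ {x} → x ∈ p → f (suc x) ∉ q′
  avoid′ {x} x∈p fx∈q′ with y∈p[x]≔inside⇒y≡x⊎y∈p q (f zero) fx∈q′
  ... | inj₁ fx≡f0 with inj (there x∈p) here fx≡f0
  ...   | ()
  avoid′ x∈p _ | inj₂ fx∈q = avoid (there x∈p) fx∈q
  ∣p∣+∣q′∣≡1+∣p∣+∣q∣ : ∣ p ∣ + ∣ q′ ∣ ≡ suc (∣ p ∣ + ∣ q ∣)
  ∣p∣+∣q′∣≡1+∣p∣+∣q∣ = trans (cong (∣ p ∣ +_) (x∉p⇒∣p[x]≔inside∣≡1+∣p∣ q (avoid here))) (+-suc ∣ p ∣ ∣ q ∣)

∣p++q∣≡∣p∣+∣q∣ : ∀ {k n} (p : Subset k) (q : Subset n) → ∣ p ++ᵥ q ∣ ≡ ∣ p ∣ + ∣ q ∣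
∣p++q∣≡∣p∣+∣q∣ [] q = refl
∣p++q∣≡∣p∣+∣q∣ (inside ∷ p) q = cong suc (∣p++q∣≡∣p∣+∣q∣ p q)
∣p++q∣≡∣p∣+∣q∣ (outside ∷ p) q = ∣p++q∣≡∣p∣+∣q∣ p q

module _ {k n} (p : Subset k) (q : Subset n) where

  x∈p⇒x↑ˡ∈p++q : ∀ {x} → x ∈ p → (x ↑ˡ n) ∈ p ++ᵥ q
  x∈p⇒x↑ˡ∈p++q {x} x∈p = lookup⇒[]= _ _ (trans (lookup-++ˡ p q x) ([]=⇒lookup x∈p))

  x↑ˡ∈p++q⇒x∈p : ∀ {x} → (x ↑ˡ n) ∈ p ++ᵥ q → x ∈ p
  x↑ˡ∈p++q⇒x∈p {x} x∈p++q = lookup⇒[]= _ _ (trans (sym (lookup-++ˡ p q x)) ([]=⇒lookup x∈p++q))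

  x∈q⇒k↑ʳx∈p++q : ∀ {x} → x ∈ q → (k ↑ʳ x) ∈ p ++ᵥ q
  x∈q⇒k↑ʳx∈p++q {x} x∈q = lookup⇒[]= _ _ (trans (lookup-++ʳ p q x) ([]=⇒lookup x∈q))

_EndpointOf_ : ∀ {A : Set} → A → A × A → Set
a EndpointOf e = proj₁ e ≡ a ⊎ proj₂ e ≡ a

NoIsolatedVertex : Graph → Set
NoIsolatedVertex G = ∀ a → ∃[ e ] (e ∈ₗ E G × a EndpointOf e)

edges-leave⇒Independent : ∀ G (S : Subset (V G)) →
  (∀ {a b} → (a , b) ∈ₗ E G → a ∉ S ⊎ b ∉ S) → Independent G S
edges-leave⇒Independent G S leave a b (inj₁ ab∈E) a∈S b∈S with leave ab∈E
... | inj₁ a∉S = a∉S a∈S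
... | inj₂ b∉S = b∉S b∈S
edges-leave⇒Independent G S leave a b (inj₂ ba∈E) a∈S b∈S with leave ba∈E
... | inj₁ b∉S = b∉S b∈S
... | inj₂ a∉S = a∉S a∈S

independent-common-edge⇒≡ : ∀ G {S a a′} {e : Fin (V G) × Fin (V G)} → Independent G S →
  e ∈ₗ E G → a EndpointOf e → a′ EndpointOf e → a ∈ S → a′ ∈ S → a ≡ a′
independent-common-edge⇒≡ G ind e∈E (inj₁ refl) (inj₁ refl) _ _ = refl
independent-common-edge⇒≡ G ind e∈E (inj₂ refl) (inj₂ refl) _ _ = refl
independent-common-edge⇒≡ G ind e∈E (inj₁ refl) (inj₂ refl) a∈S a′∈S = ⊥-elim (ind _ _ (inj₁ e∈E) a∈S a′∈S)
independent-common-edge⇒≡ G ind e∈E (inj₂ refl) (inj₁ refl) a∈S a′∈S = ⊥-elim (ind _ _ (inj₂ e∈E) a∈S a′∈S)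

length-concatMap-const : ∀ {A B : Set} k (f : A → List B) → (∀ x → length (f x) ≡ k) →
  ∀ xs → length (concatMap f xs) ≡ k * length xs
length-concatMap-const k f len-f []ₗ = sym (*-zeroʳ k)
length-concatMap-const k f len-f (x ∷ₗ xs) = begin
  length (f x ++ₗ concatMap f xs)        ≡⟨ length-++ (f x) ⟩
  length (f x) + length (concatMap f xs) ≡⟨ cong₂ _+_ (len-f x) (length-concatMap-const k f len-f xs) ⟩
  k + k * length xs                      ≡⟨ sym (*-suc k (length xs)) ⟩
  k * suc (length xs)                    ∎
  where open ≡-Reasoning

data StepVertex (v m : ℕ) : Fin (v + m) → Set where
  old : ∀ a → StepVertex v m (a ↑ˡ m)
  new : ∀ i → StepVertex v m (v ↑ʳ i)

stepVertex : ∀ v m (x : Fin (v + m)) → StepVertex v m x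
stepVertex zero m x = new x
stepVertex (suc v) m zero = old zero
stepVertex (suc v) m (suc x) with stepVertex v m x
... | old a = old (suc a)
... | new i = new i

module _ (G : Graph) where

  private
    v = V G
    m = length (E G)
    -- The local functions of step, which unification cannot recover from E (step G).
    liftEdge : Fin v × Fin v → Fin (v + m) × Fin (v + m)
    liftEdge (a , b) = a ↑ˡ m , b ↑ˡ m
    newEdges : Fin m → List (Fin (v + m) × Fin (v + m))
    newEdges i = (v ↑ʳ i , proj₁ (lookup (E G) i) ↑ˡ m) ∷ₗ (v ↑ʳ i , proj₂ (lookup (E G) i) ↑ˡ m) ∷ₗ []ₗ

  oldEdge : ∀ {a b} → (a , b) ∈ₗ E G → (a ↑ˡ m , b ↑ˡ m) ∈ₗ E (step G)
  oldEdge ab∈E = ∈-++⁺ˡ (∈-map⁺ liftEdge ab∈E)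

  newEdge : ∀ i {a} → a EndpointOf lookup (E G) i → (v ↑ʳ i , a ↑ˡ m) ∈ₗ E (step G)
  newEdge i (inj₁ refl) = ∈-++⁺ʳ _ (∈-concatMap⁺ newEdges (lose (∈-allFin i) (hereₗ refl)))
  newEdge i (inj₂ refl) = ∈-++⁺ʳ _ (∈-concatMap⁺ newEdges (lose (∈-allFin i) (thereₗ (hereₗ refl))))

  step-edge-target-old : ∀ {x y} → (x , y) ∈ₗ E (step G) → ∃[ b ] y ≡ b ↑ˡ m
  step-edge-target-old xy∈E with ∈-++⁻ (map liftEdge (E G)) xy∈E
  ... | inj₁ xy∈old with ∈-map⁻ liftEdge xy∈old
  ...   | (_ , b) , _ , refl = b , refl
  step-edge-target-old xy∈E | inj₂ xy∈new with satisfied (∈-concatMap⁻ newEdges {allFin m} xy∈new)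
  ... | i , hereₗ refl = _ , refl
  ... | i , thereₗ (hereₗ refl) = _ , refl

  length-E-step : length (E (step G)) ≡ 3 * m
  length-E-step = begin
    length (E (step G))
      ≡⟨ length-++ (map liftEdge (E G)) ⟩
    length (map liftEdge (E G)) + length (concatMap newEdges (allFin m))
      ≡⟨ cong₂ _+_ (length-map liftEdge (E G)) (length-concatMap-const 2 newEdges (λ _ → refl) (allFin m)) ⟩
    m + 2 * length (allFin m)
      ≡⟨ cong (λ l → m + 2 * l) (length-tabulate {n = m} (λ i → i)) ⟩
    3 * m ∎
    where open ≡-Reasoning

  step-noIsolatedVertex : NoIsolatedVertex G → NoIsolatedVertex (step G)
  step-noIsolatedVertex noIso x with stepVertex v m x
  ... | old a with noIso a
  ...   | _ , e∈E , inj₁ refl = _ , oldEdge e∈E , inj₁ refl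
  ...   | _ , e∈E , inj₂ refl = _ , oldEdge e∈E , inj₂ refl
  step-noIsolatedVertex noIso x | new i = _ , newEdge i (inj₁ refl) , inj₁ refl

  newVertices : Subset (v + m)
  newVertices = ∅ {v} ++ᵥ all {m}

  newVertices-independent : Independent (step G) newVertices
  newVertices-independent = edges-leave⇒Independent (step G) newVertices (λ ab∈E → inj₂ (target∉ ab∈E))
    where
    target∉ : ∀ {a b} → (a , b) ∈ₗ E (step G) → b ∉ newVertices
    target∉ ab∈E with step-edge-target-old ab∈E
    ... | b , refl = λ b∈ → ∉⊥ (x↑ˡ∈p++q⇒x∈p ∅ all b∈)

  ∣newVertices∣≡m : ∣ newVertices ∣ ≡ m
  ∣newVertices∣≡m = trans (∣p++q∣≡∣p∣+∣q∣ (∅ {v}) (all {m})) (cong₂ _+_ (∣⊥∣≡0 v) (∣⊤∣≡n m))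

  independent-old-part : ∀ A B → Independent (step G) (A ++ᵥ B) → Independent G A
  independent-old-part A B ind a b adj a∈A b∈A =
    ind _ _ (Sum.map oldEdge oldEdge adj) (x∈p⇒x↑ˡ∈p++q A B a∈A) (x∈p⇒x↑ˡ∈p++q A B b∈A)

  step-independent-bound : NoIsolatedVertex G → ∀ S → Independent (step G) S → ∣ S ∣ ≤ m
  step-independent-bound noIso S ind with splitAt v S
  ... | A , B , refl =
    subst (_≤ m) (sym (∣p++q∣≡∣p∣+∣q∣ A B)) (injective-avoiding⇒∣p∣+∣q∣≤n A B edgeIndex injective avoid)
    where
    edgeIndex : Fin v → Fin m
    edgeIndex a = index (proj₁ (proj₂ (noIso a)))
    endpoint : ∀ a → a EndpointOf lookup (E G) (edgeIndex a)
    endpoint a = subst (a EndpointOf_) (lookup-index (proj₁ (proj₂ (noIso a)))) (proj₂ (proj₂ (noIso a)))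
    injective : ∀ {a a′} → a ∈ A → a′ ∈ A → edgeIndex a ≡ edgeIndex a′ → a ≡ a′
    injective {a} {a′} a∈A a′∈A eq =
      independent-common-edge⇒≡ G (independent-old-part A B ind) (∈-lookup (edgeIndex a)) (endpoint a)
        (subst (λ i → a′ EndpointOf lookup (E G) i) (sym eq) (endpoint a′)) a∈A a′∈A
    avoid : ∀ {a} → a ∈ A → edgeIndex a ∉ B
    avoid {a} a∈A i∈B =
      ind _ _ (inj₁ (newEdge (edgeIndex a) (endpoint a))) (x∈q⇒k↑ʳx∈p++q A B i∈B) (x∈p⇒x↑ˡ∈p++q A B a∈A)

  step-independenceNumber : NoIsolatedVertex G → IndependenceNumber (step G) m
  step-independenceNumber noIso =
    (newVertices , newVertices-independent , ∣newVertices∣≡m) , step-independent-bound noIso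

triangle-noIsolatedVertex : NoIsolatedVertex triangle
triangle-noIsolatedVertex zero = _ , hereₗ refl , inj₁ refl
triangle-noIsolatedVertex (suc zero) = _ , hereₗ refl , inj₂ refl
triangle-noIsolatedVertex (suc (suc zero)) = _ , thereₗ (hereₗ refl) , inj₂ refl

triangle-independent-bound : ∀ S → Independent triangle S → ∣ S ∣ ≤ 1
triangle-independent-bound (outside ∷ outside ∷ outside ∷ []) _ = z≤n
triangle-independent-bound (outside ∷ outside ∷ inside ∷ []) _ = s≤s z≤n
triangle-independent-bound (outside ∷ inside ∷ outside ∷ []) _ = s≤s z≤n
triangle-independent-bound (inside ∷ outside ∷ outside ∷ []) _ = s≤s z≤n
triangle-independent-bound (s ∷ inside ∷ inside ∷ []) ind = ⊥-elim (ind _ _ (inj₁ (thereₗ (hereₗ refl))) (there here) (there (there here)))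
triangle-independent-bound (inside ∷ outside ∷ inside ∷ []) ind = ⊥-elim (ind _ _ (inj₁ (thereₗ (thereₗ (hereₗ refl)))) here (there (there here)))
triangle-independent-bound (inside ∷ inside ∷ s ∷ []) ind = ⊥-elim (ind _ _ (inj₁ (hereₗ refl)) here (there here))

triangle-independenceNumber : IndependenceNumber triangle 1
triangle-independenceNumber =
  (corner , edges-leave⇒Independent triangle corner leave , refl) , triangle-independent-bound
  where
  corner : Subset 3
  corner = inside ∷ outside ∷ outside ∷ []
  leave : ∀ {a b} → (a , b) ∈ₗ E triangle → a ∉ corner ⊎ b ∉ corner
  leave (hereₗ refl) = inj₂ λ { (there ()) }
  leave (thereₗ (hereₗ refl)) = inj₁ λ { (there ()) }
  leave (thereₗ (thereₗ (hereₗ refl))) = inj₂ λ { (there (there ())) }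

web-noIsolatedVertex : ∀ k → NoIsolatedVertex (web k)
web-noIsolatedVertex zero = triangle-noIsolatedVertex
web-noIsolatedVertex (suc k) = step-noIsolatedVertex (web k) (web-noIsolatedVertex k)

length-E-web : ∀ k → length (E (web k)) ≡ 3 ^ suc k
length-E-web zero = refl
length-E-web (suc k) = trans (length-E-step (web k)) (cong (3 *_) (length-E-web k))

mainTheorem1 : ∀ (n : ℕ) → 1 ≤ n → IndependenceNumber (𝒢 n) (3 ^ (n ∸ 1))
mainTheorem1 (suc zero) _ = triangle-independenceNumber
mainTheorem1 (suc (suc k)) _ =
  subst (IndependenceNumber (web (suc k))) (length-E-web k)
    (step-independenceNumber (web k) (web-noIsolatedVertex k))
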